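{- Let $N$ be a binary matroid and $a\in E(N)$. If $N\backslash a\cong F_7$ and $N/a$ is graphic, then $N/a$ is isomorphic to $M(G_{12})$, where $G_{12}$ is the graph on three vertices obtained from a triangle by adding one parallel edge to each of its three edges and then adding one loop (7 edges in total). -}

module Defs where

open import Data.Nat using (ℕ; zero; suc; _≥_)
open import Data.Nat.DivMod using (_%_; m%n<n)
open import Data.Bool using (Bool; true; false; _xor_; _∧_)
open import Data.Fin using (Fin; zero; suc; toℕ; fromℕ<; punchOut)
import Data.Fin as F
open import Data.Product using (Σ; _×_; _,_)
open import Data.Sum using (_⊎_)
open import Relation.Binary.PropositionalEquality using (_≡_)
open import Relation.Nullary using (¬_; yes; no)
open import Function.Bundles using (_↔_; Inverse)
open import Function.Definitions using (Injective)

Indep : ℕ → Set₁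
Indep n = (Fin n → Bool) → Set

-- Binary matroids: the column matroid of a matrix over GF(2) = Bool
-- (addition = xor, multiplication = ∧).

⊕ : ∀ {n} → (Fin n → Bool) → Bool
⊕ {zero}  f = false
⊕ {suc n} f = f zero xor ⊕ (λ j → f (suc j))

BinIndep : ∀ {r n} → (Fin r → Fin n → Bool) → Indep n
BinIndep {r} {n} A S =
  (c : Fin n → Bool) →
  (∀ j → c j ≡ true → S j ≡ true) →
  (∀ i → ⊕ (λ j → c j ∧ A i j) ≡ false) →
  ∀ j → c j ≡ false

-- Deletion and contraction of an element a : Fin (suc n); the ground
-- set E - a is identified with Fin n via punchOut / punchIn.

ext : ∀ {n} → Fin (suc n) → (Fin n → Bool) → Fin (suc n) → Bool
ext a J x with a F.≟ x
... | yes _ = false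
... | no a≢x = J (punchOut a≢x)

ins : ∀ {n} → Fin (suc n) → (Fin n → Bool) → Fin (suc n) → Bool
ins a J x with a F.≟ x
... | yes _ = true
... | no a≢x = J (punchOut a≢x)

single : ∀ {n} → Fin n → Fin n → Bool
single a x with a F.≟ x
... | yes _ = true
... | no _ = false

delete : ∀ {n} → Indep (suc n) → Fin (suc n) → Indep n
delete M a J = M (ext a J)

contract : ∀ {n} → Indep (suc n) → Fin (suc n) → Indep n
contract M a J =
  (¬ M (single a) × M (ext a J)) ⊎ (M (single a) × M (ins a J))

_≅_ : ∀ {n m} → Indep n → Indep m → Set
_≅_ {n} {m} M M' =
  Σ (Fin n ↔ Fin m) λ σ →
    ∀ (J : Fin m → Bool) →
      (M' J → M (λ x → J (Inverse.to σ x))) × (M (λ x → J (Inverse.to σ x)) → M' J)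

-- Graphs (multigraphs with loops) with v vertices and edge set Fin m,
-- given by the (unordered) pair of endpoints of each edge.

Graph : ℕ → ℕ → Set
Graph v m = Fin m → Fin v × Fin v

Joins : ∀ {v} → Fin v × Fin v → Fin v → Fin v → Set
Joins (x , y) u w = (x ≡ u × y ≡ w) ⊎ (x ≡ w × y ≡ u)

next : ∀ {k} → Fin (suc k) → Fin (suc k)
next {k} i = fromℕ< (m%n<n (suc (toℕ i)) (suc k))

-- A cycle of G contained in the edge set I: k+1 ≥ 1 distinct edges
-- e₀ … e_k and k+1 distinct vertices v₀ … v_k with e_i joining v_i and
-- v_{i+1 mod k+1}.  (k = 0: a loop; k = 1: a pair of parallel edges.)
CycleIn : ∀ {v m} → Graph v m → (Fin m → Bool) → Set
CycleIn {v} {m} G I =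
  Σ ℕ λ k →
  Σ (Fin (suc k) → Fin m) λ e →
  Σ (Fin (suc k) → Fin v) λ w →
    Injective _≡_ _≡_ e × Injective _≡_ _≡_ w ×
    (∀ i → Joins (G (e i)) (w i) (w (next i))) ×
    (∀ i → I (e i) ≡ true)

CycleMatroid : ∀ {v m} → Graph v m → Indep m
CycleMatroid G I = ¬ CycleIn G I

Graphic : ∀ {m} → Indep m → Set
Graphic {m} M =
  Σ ℕ λ v → Σ (Graph v m) λ G →
    ∀ I → (M I → CycleMatroid G I) × (CycleMatroid G I → M I)

-- The Fano matroid F₇: the binary matroid whose 7 columns are all the
-- nonzero vectors of GF(2)³ (column j is the binary expansion of j+1).

fanoMatrix : Fin 3 → Fin 7 → Bool
fanoMatrix zero zero = true
fanoMatrix zero (suc zero) = false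
fanoMatrix zero (suc (suc zero)) = true
fanoMatrix zero (suc (suc (suc zero))) = false
fanoMatrix zero (suc (suc (suc (suc zero)))) = true
fanoMatrix zero (suc (suc (suc (suc (suc zero))))) = false
fanoMatrix zero (suc (suc (suc (suc (suc (suc zero)))))) = true
fanoMatrix (suc zero) zero = false
fanoMatrix (suc zero) (suc zero) = true
fanoMatrix (suc zero) (suc (suc zero)) = true
fanoMatrix (suc zero) (suc (suc (suc zero))) = false
fanoMatrix (suc zero) (suc (suc (suc (suc zero)))) = false
fanoMatrix (suc zero) (suc (suc (suc (suc (suc zero))))) = true
fanoMatrix (suc zero) (suc (suc (suc (suc (suc (suc zero)))))) = true
fanoMatrix (suc (suc zero)) zero = false
fanoMatrix (suc (suc zero)) (suc zero) = false
fanoMatrix (suc (suc zero)) (suc (suc zero)) = false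
fanoMatrix (suc (suc zero)) (suc (suc (suc zero))) = true
fanoMatrix (suc (suc zero)) (suc (suc (suc (suc zero)))) = true
fanoMatrix (suc (suc zero)) (suc (suc (suc (suc (suc zero))))) = true
fanoMatrix (suc (suc zero)) (suc (suc (suc (suc (suc (suc zero)))))) = true

F₇ : Indep 7
F₇ = BinIndep fanoMatrix

G₁₂ : Graph 3 7
G₁₂ zero = (zero , suc zero)
G₁₂ (suc zero) = (suc zero , suc (suc zero))
G₁₂ (suc (suc zero)) = (suc (suc zero) , zero)
G₁₂ (suc (suc (suc zero))) = (zero , suc zero)
G₁₂ (suc (suc (suc (suc zero)))) = (suc zero , suc (suc zero))
G₁₂ (suc (suc (suc (suc (suc zero))))) = (suc (suc zero) , zero)
G₁₂ (suc (suc (suc (suc (suc (suc zero)))))) = (zero , zero)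

-- Reorder the columns of A so that column 0 is a and column
-- 1+t is the element of N\a that the isomorphism sends to the Fano point t
-- (the matrix B of module NormalForm).  Every Fano line is a circuit of
-- N\a, so its indicator vector is a dependency (kernel vector) of B;
-- consequently every row of B has the shape (w , x·F) with w ∈ GF(2),
-- x ∈ GF(2)³ and F the Fano matrix.  With this shape, whether a vector is a
-- dependency of B follows from finitely many checks.  Now distinguish the
-- position of the column a:
--   * a is a loop, or a is parallel to no Fano point: then N/a keeps every
--     pair of Fano points independent and every line dependent, and no
--     graph realises such a matroid (the usual proof that F₇ is not
--     graphic);
--   * a is parallel to the Fano point m: then the dependency a + m makes the
--     rows (x·F_m , x·F), and an explicit bijection π m matches the
--     independent sets of N/a with the forests of G₁₂.
module Submission where

open import Defs
open import Data.Nat using (ℕ; zero; suc; _≤_; s≤s)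
open import Data.Bool using (Bool; true; false; _xor_; _∧_; _∨_; not; if_then_else_)
import Data.Bool.Properties as BoolP
open import Data.Fin using (Fin; zero; suc; punchIn)
open import Data.Fin.Patterns using (0F; 1F; 2F; 3F; 4F; 5F; 6F; 7F; 8F; 9F)
import Data.Fin.Properties as FinP
import Data.Fin.Permutation as Perm
open import Data.Vec.Functional using () renaming ([] to []ᵥ; _∷_ to _∷ᵥ_)
open import Data.List using (List; []; _∷_; _++_; tabulate)
open import Data.List.Relation.Unary.All using (All; []; _∷_)
import Data.List.Relation.Unary.All.Properties as AllP
open import Data.Product using (Σ; _×_; _,_; proj₁; proj₂)
open import Data.Sum using (_⊎_; inj₁; inj₂)
open import Data.Empty using (⊥; ⊥-elim)
open import Relation.Nullary using (¬_; yes; no; Dec; does; contradiction)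
open import Relation.Binary.PropositionalEquality
open import Function.Bundles using (_↔_; Inverse)
open import Function.Definitions using (Injective)
open import Algebra.Bundles using (CommutativeRing)
open CommutativeRing BoolP.xor-∧-commutativeRing using (+-commutativeMonoid)
open import Algebra.Properties.CommutativeMonoid.Sum +-commutativeMonoid
  using (sum; sum-permute)
open import Algebra.Solver.CommutativeMonoid +-commutativeMonoid
  using (solve; _⊜_) renaming (_⊕_ to _⊞_)

-- Boolean decision procedures over finite domains
--
-- All finite facts below (about F₇, G₁₂ and the shape of B) are proved by
-- evaluating a Boolean check to 'true'; these are the checks and their
-- soundness lemmas.

true≢false : true ≢ false
true≢false ()

∧-true : ∀ {a b} → a ∧ b ≡ true → a ≡ true × b ≡ true
∧-true {a} {b} h = BoolP.∧-conicalˡ a b h , BoolP.∧-conicalʳ a b h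

∨-true : ∀ {a b} → a ∨ b ≡ true → a ≡ true ⊎ b ≡ true
∨-true {true}  _ = inj₁ refl
∨-true {false} h = inj₂ h

∨-false : ∀ {a b} → a ≡ false → a ∨ b ≡ true → b ≡ true
∨-false refl h = h

-- 'not a ∨ b' is the Boolean implication a ⇒ b.
modus-ponens : ∀ {a b} → not a ∨ b ≡ true → a ≡ true → b ≡ true
modus-ponens {true} h refl = h

_==_ : ∀ {n} → Fin n → Fin n → Bool
x == y = does (x FinP.≟ y)

==-sound : ∀ {n} {x y : Fin n} → (x == y) ≡ true → x ≡ y
==-sound {x = x} {y} h with x FinP.≟ y
... | yes x≡y = x≡y

==-refl : ∀ {n} (x : Fin n) → (x == x) ≡ true
==-refl x with x FinP.≟ x
... | yes _   = refl
... | no x≢x = ⊥-elim (x≢x refl)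

==-distinct : ∀ {n} {x y : Fin n} → x ≢ y → (x == y) ≡ false
==-distinct {x = x} {y} x≢y with x FinP.≟ y
... | yes x≡y = ⊥-elim (x≢y x≡y)
... | no _    = refl

allFin : ∀ n → (Fin n → Bool) → Bool
allFin zero    P = true
allFin (suc n) P = P zero ∧ allFin n (λ i → P (suc i))

allFin-sound : ∀ n P → allFin n P ≡ true → ∀ i → P i ≡ true
allFin-sound (suc n) P h zero    = proj₁ (∧-true h)
allFin-sound (suc n) P h (suc i) = allFin-sound n (λ j → P (suc j)) (proj₂ (∧-true h)) i

allFin-complete : ∀ n P → (∀ i → P i ≡ true) → allFin n P ≡ true
allFin-complete zero    P h = refl
allFin-complete (suc n) P h rewrite h zero = allFin-complete n (λ j → P (suc j)) (λ i → h (suc i))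

allFin²-sound : ∀ m n (P : Fin m → Fin n → Bool) →
                allFin m (λ x → allFin n (P x)) ≡ true → ∀ x y → P x y ≡ true
allFin²-sound m n P h x = allFin-sound n (P x) (allFin-sound m _ h x)

allFin³-sound : ∀ l m n (P : Fin l → Fin m → Fin n → Bool) →
                allFin l (λ x → allFin m (λ y → allFin n (P x y))) ≡ true →
                ∀ x y z → P x y z ≡ true
allFin³-sound l m n P h x = allFin²-sound m n (P x) (allFin-sound l _ h x)

anyFin : ∀ n → (Fin n → Bool) → Bool
anyFin zero    P = false
anyFin (suc n) P = P zero ∨ anyFin n (λ i → P (suc i))

anyFin-sound : ∀ n P → anyFin n P ≡ true → Σ (Fin n) λ i → P i ≡ true
anyFin-sound (suc n) P h with ∨-true {P zero} h
... | inj₁ p = zero , p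
... | inj₂ p with anyFin-sound n (λ j → P (suc j)) p
...   | i , q = suc i , q

anyFin-false : ∀ n P → anyFin n P ≡ false → ∀ i → P i ≡ false
anyFin-false (suc n) P h zero    = BoolP.∨-conicalˡ (P zero) _ h
anyFin-false (suc n) P h (suc i) =
  anyFin-false n (λ j → P (suc j)) (BoolP.∨-conicalʳ (P zero) _ h) i

-- A Boolean vector, rebuilt from its entries.  A check quantifying over
-- all vectors only reaches vectors in this form.
normalise : ∀ {n} → (Fin n → Bool) → Fin n → Bool
normalise {zero}  x = []ᵥ
normalise {suc n} x = x zero ∷ᵥ normalise (λ j → x (suc j))

normalise-≗ : ∀ {n} (x : Fin n → Bool) j → normalise x j ≡ x j
normalise-≗ {suc n} x zero    = refl
normalise-≗ {suc n} x (suc j) = normalise-≗ (λ i → x (suc i)) j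

allVec : ∀ n → ((Fin n → Bool) → Bool) → Bool
allVec zero    P = P []ᵥ
allVec (suc n) P = allVec n (λ x → P (false ∷ᵥ x)) ∧ allVec n (λ x → P (true ∷ᵥ x))

allVec-sound : ∀ n P → allVec n P ≡ true → ∀ x → P (normalise x) ≡ true
allVec-sound zero    P h x = h
allVec-sound (suc n) P h x with x zero
... | false = allVec-sound n (λ y → P (false ∷ᵥ y)) (proj₁ (∧-true h)) (λ j → x (suc j))
... | true  = allVec-sound n (λ y → P (true ∷ᵥ y)) (proj₂ (∧-true h)) (λ j → x (suc j))

⊕-cong : ∀ {n} {f g : Fin n → Bool} → (∀ j → f j ≡ g j) → ⊕ f ≡ ⊕ g
⊕-cong {zero}  h = refl
⊕-cong {suc n} h = cong₂ _xor_ (h zero) (⊕-cong (λ j → h (suc j)))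

⊕≡sum : ∀ {n} (f : Fin n → Bool) → ⊕ f ≡ sum f
⊕≡sum {zero}  f = refl
⊕≡sum {suc n} f = cong (f zero xor_) (⊕≡sum (λ j → f (suc j)))

⊕-permute : ∀ {n} (f : Fin n → Bool) (π : Fin n ↔ Fin n) →
            ⊕ f ≡ ⊕ (λ j → f (Inverse.to π j))
⊕-permute f π =
  trans (⊕≡sum f) (trans (sum-permute f π) (sym (⊕≡sum (λ j → f (Inverse.to π j)))))

xor3 : (Fin 3 → Bool) → Bool
xor3 g = g 0F xor (g 1F xor g 2F)

xor3-reindex : ∀ (g : Fin 3 → Bool) (f : Fin 3 → Fin 3) → Injective _≡_ _≡_ f →
               xor3 (λ i → g (f i)) ≡ xor3 g
xor3-reindex g f f-inj with f 0F in e₀ | f 1F in e₁ | f 2F in e₂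
... | 0F | 1F | 2F = refl
... | 0F | 2F | 1F = solve 3 (λ x y z → x ⊞ (z ⊞ y) ⊜ x ⊞ (y ⊞ z)) refl (g 0F) (g 1F) (g 2F)
... | 1F | 0F | 2F = solve 3 (λ x y z → y ⊞ (x ⊞ z) ⊜ x ⊞ (y ⊞ z)) refl (g 0F) (g 1F) (g 2F)
... | 1F | 2F | 0F = solve 3 (λ x y z → y ⊞ (z ⊞ x) ⊜ x ⊞ (y ⊞ z)) refl (g 0F) (g 1F) (g 2F)
... | 2F | 0F | 1F = solve 3 (λ x y z → z ⊞ (x ⊞ y) ⊜ x ⊞ (y ⊞ z)) refl (g 0F) (g 1F) (g 2F)
... | 2F | 1F | 0F = solve 3 (λ x y z → z ⊞ (y ⊞ x) ⊜ x ⊞ (y ⊞ z)) refl (g 0F) (g 1F) (g 2F)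
... | 0F | 0F | _  = contradiction (f-inj (trans e₀ (sym e₁))) λ ()
... | 1F | 1F | _  = contradiction (f-inj (trans e₀ (sym e₁))) λ ()
... | 2F | 2F | _  = contradiction (f-inj (trans e₀ (sym e₁))) λ ()
... | 0F | _  | 0F = contradiction (f-inj (trans e₀ (sym e₂))) λ ()
... | 1F | _  | 1F = contradiction (f-inj (trans e₀ (sym e₂))) λ ()
... | 2F | _  | 2F = contradiction (f-inj (trans e₀ (sym e₂))) λ ()
... | _  | 0F | 0F = contradiction (f-inj (trans e₁ (sym e₂))) λ ()
... | _  | 1F | 1F = contradiction (f-inj (trans e₁ (sym e₂))) λ ()
... | _  | 2F | 2F = contradiction (f-inj (trans e₁ (sym e₂))) λ ()

-- Binary matroids: kernel vectors and certificates of (in)dependence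

dot : ∀ {n} → (Fin n → Bool) → (Fin n → Bool) → Bool
dot c x = ⊕ (λ j → c j ∧ x j)

Kernel : ∀ {r n} → (Fin r → Fin n → Bool) → (Fin n → Bool) → Set
Kernel A c = ∀ i → dot c (A i) ≡ false

_⊆_ : ∀ {n} → (Fin n → Bool) → (Fin n → Bool) → Set
S ⊆ T = ∀ j → S j ≡ true → T j ≡ true

∷-⊆ : ∀ {n} b {S T : Fin n → Bool} → S ⊆ T → (b ∷ᵥ S) ⊆ (b ∷ᵥ T)
∷-⊆ b S⊆T 0F      b≡true = b≡true
∷-⊆ b S⊆T (suc j) Sⱼ     = S⊆T j Sⱼ

dot-cong : ∀ {n} {c c′ x x′ : Fin n → Bool} →
           (∀ j → c j ≡ c′ j) → (∀ j → x j ≡ x′ j) → dot c x ≡ dot c′ x′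
dot-cong hc hx = ⊕-cong (λ j → cong₂ _∧_ (hc j) (hx j))

Kernel-cong : ∀ {r n} {A : Fin r → Fin n → Bool} {c d} →
              (∀ j → c j ≡ d j) → Kernel A c → Kernel A d
Kernel-cong c≗d z i = trans (sym (dot-cong c≗d (λ _ → refl))) (z i)

∅ : ∀ {n} → Fin n → Bool
∅ _ = false

Kernel-zero : ∀ {r n} (A : Fin r → Fin n → Bool) → Kernel A ∅
Kernel-zero {n = zero}  A i = refl
Kernel-zero {n = suc n} A i = Kernel-zero (λ i′ j → A i′ (suc j)) i

indep⇒no-dependency : ∀ {r n} {A : Fin r → Fin n → Bool} {T c} → BinIndep A T →
                      c ⊆ T → Kernel A c → ∀ j → c j ≡ true → ⊥
indep⇒no-dependency indep c⊆T z j cⱼ = true≢false (trans (sym cⱼ) (indep _ c⊆T z j))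

BinIndep-mono : ∀ {r n} {A : Fin r → Fin n → Bool} {S T} →
                S ⊆ T → BinIndep A T → BinIndep A S
BinIndep-mono S⊆T indep c c⊆S = indep c (λ j cⱼ → S⊆T j (c⊆S j cⱼ))

BinIndep-≗ : ∀ {r n} {A : Fin r → Fin n → Bool} {S T} →
             (∀ j → S j ≡ T j) → BinIndep A T → BinIndep A S
BinIndep-≗ S≗T = BinIndep-mono (λ j Sⱼ → trans (sym (S≗T j)) Sⱼ)

module ColumnPermutation {n : ℕ} (π : Fin n ↔ Fin n) where
  private
    to   = Inverse.to π
    from = Inverse.from π

    to-from : ∀ y → to (from y) ≡ y
    to-from y = Inverse.inverseˡ π refl

    from-to : ∀ x → from (to x) ≡ x
    from-to x = Inverse.inverseʳ π refl

  permute : ∀ {r} {A : Fin r → Fin n → Bool} {S} → BinIndep A S →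
            BinIndep (λ i j → A i (to j)) (λ j → S (to j))
  permute {A = A} {S} indep c c⊆S z j =
    trans (sym (cong c (from-to j))) (indep c′ c′⊆S c′∈ker (to j))
    where
    c′ : Fin n → Bool
    c′ k = c (from k)
    c′⊆S : c′ ⊆ S
    c′⊆S k c′ₖ = subst (λ y → S y ≡ true) (to-from k) (c⊆S (from k) c′ₖ)
    c′∈ker : Kernel A c′
    c′∈ker i = trans (⊕-permute (λ k → c′ k ∧ A i k) π)
                     (trans (⊕-cong (λ k → cong (λ y → c y ∧ A i (to k)) (from-to k))) (z i))

  unpermute : ∀ {r} {A : Fin r → Fin n → Bool} {S} →
              BinIndep (λ i j → A i (to j)) (λ j → S (to j)) → BinIndep A S
  unpermute {A = A} {S} indep c c⊆S z j =
    trans (sym (cong c (to-from j))) (indep (λ k → c (to k)) (λ k → c⊆S (to k)) c∘to∈ker (from j))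
    where
    c∘to∈ker : Kernel (λ i k → A i (to k)) (λ k → c (to k))
    c∘to∈ker i = trans (sym (⊕-permute (λ k → c k ∧ A i k) π)) (z i)

_⊆ᵇ_ : ∀ {n} → (Fin n → Bool) → (Fin n → Bool) → Bool
_⊆ᵇ_ {n} c S = allFin n (λ j → not (c j) ∨ S j)

⊆ᵇ-complete : ∀ {n} {c S : Fin n → Bool} → c ⊆ S → (c ⊆ᵇ S) ≡ true
⊆ᵇ-complete {n} {c} {S} c⊆S = allFin-complete n _ pointwise
  where
  pointwise : ∀ j → not (c j) ∨ S j ≡ true
  pointwise j with c j in cⱼ
  ... | false = refl
  ... | true  = c⊆S j cⱼ

⊆ᵇ-sound : ∀ {n} {c S : Fin n → Bool} → (c ⊆ᵇ S) ≡ true → c ⊆ S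
⊆ᵇ-sound {n} {c} h j cⱼ = modus-ponens (allFin-sound n _ h j) cⱼ

nonzero : ∀ {n} → (Fin n → Bool) → Bool
nonzero {n} c = anyFin n c

_≐ᵇ_ : ∀ {n} → (Fin n → Bool) → (Fin n → Bool) → Bool
_≐ᵇ_ {n} c d = allFin n (λ j → not (c j xor d j))

≐ᵇ-sound : ∀ {n} {c d : Fin n → Bool} → (c ≐ᵇ d) ≡ true → ∀ j → c j ≡ d j
≐ᵇ-sound {n} {c} {d} h j = xor-false (c j) (d j) (BoolP.not-injective (allFin-sound n _ h j))
  where
  xor-false : ∀ a b → a xor b ≡ false → a ≡ b
  xor-false false false _ = refl
  xor-false true  true  _ = refl

_∈ᵇ_ : ∀ {n} → (Fin n → Bool) → List (Fin n → Bool) → Bool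
c ∈ᵇ []      = false
c ∈ᵇ (k ∷ K) = (c ≐ᵇ k) ∨ (c ∈ᵇ K)

∈ᵇ-nondependency : ∀ {r n} {A : Fin r → Fin n → Bool} {c} K →
                   All (λ k → ¬ Kernel A k) K → (c ∈ᵇ K) ≡ true → ¬ Kernel A c
∈ᵇ-nondependency {A = A} {c = c} (k ∷ K) (k∉ker ∷ K∉ker) h z with ∨-true {c ≐ᵇ k} h
... | inj₁ c≐k = k∉ker (Kernel-cong {A = A} (≐ᵇ-sound {c = c} {d = k} c≐k) z)
... | inj₂ c∈K = ∈ᵇ-nondependency K K∉ker c∈K z

-- Certificate of independence for a matrix A known only through a sound
-- test 'transfers' (transfers c d ⇒ (c ∈ ker A ⇒ d ∈ ker A)) and a list K
-- of vectors known to lie outside the kernel: S is independent if every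
-- nonzero c ⊆ S reduces to some 'reduce c' ∈ K with transfers c (reduce c).
IndepCertificate : ∀ {n} (transfers : (Fin n → Bool) → (Fin n → Bool) → Bool)
  (K : List (Fin n → Bool)) (reduce : (Fin n → Bool) → Fin n → Bool)
  (S : Fin n → Bool) → Bool
IndepCertificate {n} transfers K reduce S =
  allVec n (λ c → not (c ⊆ᵇ S) ∨ (not (nonzero c) ∨ ((reduce c ∈ᵇ K) ∧ transfers c (reduce c))))

certified-indep : ∀ {r n} {A : Fin r → Fin n → Bool} transfers →
  (∀ c d → transfers c d ≡ true → Kernel A c → Kernel A d) →
  ∀ K → All (λ k → ¬ Kernel A k) K → ∀ reduce S →
  IndepCertificate transfers K reduce S ≡ true → BinIndep A S
certified-indep {n = n} {A} transfers transfer-sound K K∉ker reduce S cert c c⊆S z j =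
  trans (sym (normalise-≗ c j)) cⱼ≡false
  where
  c′ = normalise c
  c′∈ker : Kernel A c′
  c′∈ker = Kernel-cong (λ j → sym (normalise-≗ c j)) z
  c′⊆S : (c′ ⊆ᵇ S) ≡ true
  c′⊆S = ⊆ᵇ-complete (λ j e → c⊆S j (trans (sym (normalise-≗ c j)) e))
  cⱼ≡false : c′ j ≡ false
  cⱼ≡false with c′ ⊆ᵇ S | c′⊆S | nonzero c′ in nz | allVec-sound n _ cert c
  ... | true | _ | false | _ = anyFin-false n c′ nz j
  ... | true | _ | true  | reduced =
    ⊥-elim (∈ᵇ-nondependency K K∉ker (proj₁ (∧-true reduced))
                             (transfer-sound c′ (reduce c′) (proj₂ (∧-true reduced)) c′∈ker))

Kernelᵇ : ∀ {r n} → (Fin r → Fin n → Bool) → (Fin n → Bool) → Bool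
Kernelᵇ {r} A c = allFin r (λ i → not (dot c (A i)))

Kernelᵇ-sound : ∀ {r n} {A : Fin r → Fin n → Bool} {c} → Kernelᵇ A c ≡ true → Kernel A c
Kernelᵇ-sound {r} h i = BoolP.not-injective (allFin-sound r _ h i)

Kernelᵇ-complete : ∀ {r n} {A : Fin r → Fin n → Bool} {c} → Kernel A c → Kernelᵇ A c ≡ true
Kernelᵇ-complete {r} z = allFin-complete r _ (λ i → cong not (z i))

Indepᵇ : ∀ {r n} → (Fin r → Fin n → Bool) → (Fin n → Bool) → Bool
Indepᵇ {n = n} A J = allVec n (λ c → not (c ⊆ᵇ J) ∨ (not (Kernelᵇ A c) ∨ not (nonzero c)))

Indepᵇ-sound : ∀ {r n} (A : Fin r → Fin n → Bool) J → Indepᵇ A J ≡ true → BinIndep A J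
Indepᵇ-sound {n = n} A J h c c⊆J z j = trans (sym (normalise-≗ c j)) cⱼ≡false
  where
  c′ = normalise c
  c′∈ker : Kernel A c′
  c′∈ker = Kernel-cong (λ j → sym (normalise-≗ c j)) z
  c′⊆J : (c′ ⊆ᵇ J) ≡ true
  c′⊆J = ⊆ᵇ-complete (λ j e → c⊆J j (trans (sym (normalise-≗ c j)) e))
  cⱼ≡false : c′ j ≡ false
  cⱼ≡false with c′ ⊆ᵇ J | c′⊆J | Kernelᵇ A c′ | Kernelᵇ-complete {A = A} c′∈ker
              | nonzero c′ in nz | allVec-sound n _ h c
  ... | true | _ | true | _ | false | _ = anyFin-false n c′ nz j

-- If every row of A is a member gen (param i)
-- of a family of vectors indexed by Boolean parameters p : Fin k → Bool,
-- then consequences between dependencies of A are decided by the 2ᵏ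
-- members: given a known dependency 'known', c ∈ ker A implies d ∈ ker A
-- as soon as every member orthogonal to 'known' and to c is orthogonal to d.
Transfersᵇ : ∀ {n k} → ((Fin k → Bool) → Fin n → Bool) → (known c d : Fin n → Bool) → Bool
Transfersᵇ {k = k} gen known c d =
  allVec k (λ p → dot known (gen p) ∨ (dot c (gen p) ∨ not (dot d (gen p))))

module RowFamily {r n k} (A : Fin r → Fin n → Bool) (gen : (Fin k → Bool) → Fin n → Bool)
  (gen-cong : ∀ {p p′} → (∀ s → p s ≡ p′ s) → ∀ j → gen p j ≡ gen p′ j)
  (param : Fin r → Fin k → Bool) (row : ∀ i j → A i j ≡ gen (param i) j) where

  transfer : ∀ {known} → Kernel A known →
             ∀ c d → Transfersᵇ gen known c d ≡ true → Kernel A c → Kernel A d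
  transfer {known} known∈ker c d checked c∈ker i =
    trans (on-row d) (BoolP.not-injective
      (∨-false (on-row′ c c∈ker) (∨-false (on-row′ known known∈ker) implication)))
    where
    member = gen (normalise (param i))
    on-row : ∀ x → dot x (A i) ≡ dot x member
    on-row x = dot-cong (λ _ → refl)
                 (λ j → trans (row i j) (gen-cong (λ s → sym (normalise-≗ (param i) s)) j))
    on-row′ : ∀ x → Kernel A x → dot x member ≡ false
    on-row′ x x∈ker = trans (sym (on-row x)) (x∈ker i)
    implication : dot known member ∨ (dot c member ∨ not (dot d member)) ≡ true
    implication =
      allVec-sound k (λ p → dot known (gen p) ∨ (dot c (gen p) ∨ not (dot d (gen p)))) checked (param i)

-- The Fano plane
--
-- Point t of F₇ is the vector t+1 of GF(2)³; the lines are the triples of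
-- points whose vectors sum to zero.

line : Fin 7 → Fin 3 → Fin 7
line 0F = 0F ∷ᵥ 1F ∷ᵥ 2F ∷ᵥ []ᵥ
line 1F = 0F ∷ᵥ 3F ∷ᵥ 4F ∷ᵥ []ᵥ
line 2F = 0F ∷ᵥ 5F ∷ᵥ 6F ∷ᵥ []ᵥ
line 3F = 1F ∷ᵥ 3F ∷ᵥ 5F ∷ᵥ []ᵥ
line 4F = 1F ∷ᵥ 4F ∷ᵥ 6F ∷ᵥ []ᵥ
line 5F = 2F ∷ᵥ 3F ∷ᵥ 6F ∷ᵥ []ᵥ
line 6F = 2F ∷ᵥ 4F ∷ᵥ 5F ∷ᵥ []ᵥ

lineSet : Fin 7 → Fin 7 → Bool
lineSet q j = (line q 0F == j) ∨ ((line q 1F == j) ∨ (line q 2F == j))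

pair : ∀ {n} → Fin n → Fin n → Fin n → Bool
pair x y j = (x == j) ∨ (y == j)

pair-fst : ∀ {n} (x y : Fin n) → pair x y x ≡ true
pair-fst x y rewrite ==-refl x = refl

pair-snd : ∀ {n} (x y : Fin n) → pair x y y ≡ true
pair-snd x y rewrite ==-refl y = BoolP.∨-zeroʳ _

line-point : ∀ q s → lineSet q (line q s) ≡ true
line-point q 0F rewrite ==-refl (line q 0F) = refl
line-point q 1F rewrite ==-refl (line q 1F) = BoolP.∨-zeroʳ _
line-point q 2F rewrite ==-refl (line q 2F) =
  trans (cong ((line q 0F == line q 2F) ∨_) (BoolP.∨-zeroʳ _)) (BoolP.∨-zeroʳ _)

lineSet-point : ∀ q j → lineSet q j ≡ true → Σ (Fin 3) λ s → line q s ≡ j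
lineSet-point q j h with ∨-true {line q 0F == j} h
... | inj₁ p = 0F , ==-sound p
... | inj₂ p with ∨-true {line q 1F == j} p
...   | inj₁ p′ = 1F , ==-sound p′
...   | inj₂ p′ = 2F , ==-sound p′

F₇-pair : ∀ x y → F₇ (pair x y)
F₇-pair x y = Indepᵇ-sound fanoMatrix (pair x y)
  (allFin²-sound 7 7 (λ x y → Indepᵇ fanoMatrix (pair x y)) checked x y)
  where
  checked : allFin 7 (λ x → allFin 7 (λ y → Indepᵇ fanoMatrix (pair x y))) ≡ true
  checked = refl

F₇-line-kernel : ∀ q → Kernel fanoMatrix (lineSet q)
F₇-line-kernel q =
  Kernelᵇ-sound {A = fanoMatrix} {c = lineSet q}
    (allFin-sound 7 (λ q → Kernelᵇ fanoMatrix (lineSet q)) checked q)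
  where
  checked : allFin 7 (λ q → Kernelᵇ fanoMatrix (lineSet q)) ≡ true
  checked = refl

F₇-line : ∀ q → ¬ F₇ (lineSet q)
F₇-line q indep = indep⇒no-dependency {A = fanoMatrix} {c = lineSet q} indep (λ _ e → e)
                    (F₇-line-kernel q) (line q 0F) (line-point q 0F)

combination : (Fin 3 → Bool) → Fin 7 → Bool
combination x t = ⊕ (λ i → x i ∧ fanoMatrix i t)

generalRow : (Fin 4 → Bool) → Fin 8 → Bool
generalRow p = p 0F ∷ᵥ combination (λ s → p (suc s))

generalRow-cong : ∀ {p p′} → (∀ s → p s ≡ p′ s) → ∀ j → generalRow p j ≡ generalRow p′ j
generalRow-cong p≗p′ 0F      = p≗p′ 0F
generalRow-cong p≗p′ (suc t) = ⊕-cong (λ i → cong (_∧ fanoMatrix i t) (p≗p′ (suc i)))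

-- The entries of a vector at position 0 and at the points 0, 1, 3 of the
-- Fano plane (whose vectors are the unit vectors of GF(2)³).
coordinates : (Fin 8 → Bool) → Fin 4 → Bool
coordinates y = y 0F ∷ᵥ y 1F ∷ᵥ y 2F ∷ᵥ y 4F ∷ᵥ []ᵥ

-- A vector (y₀ , y′) with y′ orthogonal to all lines has y′ = x·F: the
-- lines span the orthogonal complement of the row space of the Fano matrix.
orthogonal⇒generalRow : ∀ y → (∀ q → dot (false ∷ᵥ lineSet q) y ≡ false) →
                        ∀ j → y j ≡ generalRow (coordinates y) j
orthogonal⇒generalRow y y⊥ j =
  trans (sym (normalise-≗ y j))
        (≐ᵇ-sound {c = normalise y} {d = generalRow (coordinates y)}
                  (modus-ponens (allVec-sound 8 shapeᵇ refl y) y⊥ᵇ) j)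
  where
  shapeᵇ : (Fin 8 → Bool) → Bool
  shapeᵇ y = not (allFin 7 (λ q → not (dot (false ∷ᵥ lineSet q) y)))
             ∨ (y ≐ᵇ generalRow (coordinates y))
  y⊥ᵇ : allFin 7 (λ q → not (dot (false ∷ᵥ lineSet q) (normalise y))) ≡ true
  y⊥ᵇ = allFin-complete 7 (λ q → not (dot (false ∷ᵥ lineSet q) (normalise y)))
          (λ q → cong not (trans (dot-cong {c = false ∷ᵥ lineSet q} (λ _ → refl) (normalise-≗ y))
                                 (y⊥ q)))

joinsᵇ : ∀ {v} → Fin v × Fin v → Fin v → Fin v → Bool
joinsᵇ (x , y) u w = ((x == u) ∧ (y == w)) ∨ ((x == w) ∧ (y == u))

joinsᵇ-sound : ∀ {v} (P : Fin v × Fin v) u w → joinsᵇ P u w ≡ true → Joins P u w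
joinsᵇ-sound (x , y) u w h with ∨-true {(x == u) ∧ (y == w)} h
... | inj₁ p = inj₁ (==-sound (proj₁ (∧-true p)) , ==-sound (proj₂ (∧-true p)))
... | inj₂ p = inj₂ (==-sound (proj₁ (∧-true p)) , ==-sound (proj₂ (∧-true p)))

joinsᵇ-complete : ∀ {v} (P : Fin v × Fin v) u w → Joins P u w → joinsᵇ P u w ≡ true
joinsᵇ-complete (x , y) u w (inj₁ (refl , refl)) rewrite ==-refl x | ==-refl y = refl
joinsᵇ-complete (x , y) u w (inj₂ (refl , refl)) rewrite ==-refl x | ==-refl y = BoolP.∨-zeroʳ _

injectiveᵇ : ∀ {n m} → (Fin n → Fin m) → Bool
injectiveᵇ {n} f = allFin n (λ i → allFin n (λ j → not (f i == f j) ∨ (i == j)))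

injectiveᵇ-sound : ∀ {n m} (f : Fin n → Fin m) → injectiveᵇ f ≡ true → Injective _≡_ _≡_ f
injectiveᵇ-sound {n} f h {i} {j} fi≡fj =
  ==-sound (modus-ponens (allFin²-sound n n (λ i j → not (f i == f j) ∨ (i == j)) h i j)
                         (trans (cong (_== f j) fi≡fj) (==-refl (f j))))

checked-cycle : ∀ {v m} (G : Graph v m) (J : Fin m → Bool) (k : ℕ)
  (e : Fin (suc k) → Fin m) (w : Fin (suc k) → Fin v) →
  injectiveᵇ e ≡ true → injectiveᵇ w ≡ true →
  allFin (suc k) (λ i → joinsᵇ (G (e i)) (w i) (w (next i))) ≡ true →
  allFin (suc k) (λ i → J (e i)) ≡ true → CycleIn G J
checked-cycle G J k e w e-inj w-inj joins inJ =
  k , e , w , injectiveᵇ-sound e e-inj , injectiveᵇ-sound w w-inj ,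
  (λ i → joinsᵇ-sound (G (e i)) (w i) (w (next i))
           (allFin-sound (suc k) (λ i → joinsᵇ (G (e i)) (w i) (w (next i))) joins i)) ,
  allFin-sound (suc k) (λ i → J (e i)) inJ

cycle-mono : ∀ {v m} (G : Graph v m) {I J} → I ⊆ J → CycleIn G I → CycleIn G J
cycle-mono G I⊆J (k , e , w , e-inj , w-inj , joins , inI) =
  k , e , w , e-inj , w-inj , joins , (λ i → I⊆J (e i) (inI i))

module _ {v m} (G : Graph v m) (π : Fin m ↔ Fin m) where
  private
    to   = Inverse.to π
    from = Inverse.from π

    to-from : ∀ y → to (from y) ≡ y
    to-from y = Inverse.inverseˡ π refl

    from-to : ∀ x → from (to x) ≡ x
    from-to x = Inverse.inverseʳ π refl

    from-injective : ∀ {x y} → from x ≡ from y → x ≡ y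
    from-injective {x} {y} p = trans (sym (to-from x)) (trans (cong to p) (to-from y))

    to-injective : ∀ {x y} → to x ≡ to y → x ≡ y
    to-injective {x} {y} p = trans (sym (from-to x)) (trans (cong from p) (from-to y))

  renamed-cycle→ : ∀ {J} → CycleIn (λ t → G (from t)) J → CycleIn G (λ x → J (to x))
  renamed-cycle→ {J} (k , e , w , e-inj , w-inj , joins , inJ) =
    k , (λ i → from (e i)) , w , (λ p → e-inj (from-injective p)) , w-inj , joins ,
    (λ i → trans (cong J (to-from (e i))) (inJ i))

  renamed-cycle← : ∀ {J} → CycleIn G (λ x → J (to x)) → CycleIn (λ t → G (from t)) J
  renamed-cycle← {J} (k , e , w , e-inj , w-inj , joins , inJ) =
    k , (λ i → to (e i)) , w , (λ p → e-inj (to-injective p)) , w-inj ,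
    (λ i → subst (λ x → Joins (G x) (w i) (w (next i))) (sym (from-to (e i))) (joins i)) , inJ

loop-cycle : ∀ {v m} (G : Graph v m) e u → Joins (G e) u u → CycleIn G (pair e e)
loop-cycle G e u joins =
  0 , (λ _ → e) , (λ _ → u) , (λ { {0F} {0F} _ → refl }) , (λ { {0F} {0F} _ → refl }) ,
  (λ { 0F → joins }) , (λ { 0F → pair-fst e e })

parallel-cycle : ∀ {v m} (G : Graph v m) {e e′ u u′} → e ≢ e′ → u ≢ u′ →
                 Joins (G e) u u′ → Joins (G e′) u′ u → CycleIn G (pair e e′)
parallel-cycle G {e} {e′} {u} {u′} e≢e′ u≢u′ joins joins′ =
  1 , edge , vertex , edge-inj , vertex-inj ,
  (λ { 0F → joins ; 1F → joins′ }) , (λ { 0F → pair-fst e e′ ; 1F → pair-snd e e′ })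
  where
  edge : Fin 2 → _
  edge 0F = e
  edge 1F = e′
  vertex : Fin 2 → _
  vertex 0F = u
  vertex 1F = u′
  edge-inj : Injective _≡_ _≡_ edge
  edge-inj {0F} {0F} _ = refl
  edge-inj {0F} {1F} p = ⊥-elim (e≢e′ p)
  edge-inj {1F} {0F} p = ⊥-elim (e≢e′ (sym p))
  edge-inj {1F} {1F} _ = refl
  vertex-inj : Injective _≡_ _≡_ vertex
  vertex-inj {0F} {0F} _ = refl
  vertex-inj {0F} {1F} p = ⊥-elim (u≢u′ p)
  vertex-inj {1F} {0F} p = ⊥-elim (u≢u′ (sym p))
  vertex-inj {1F} {1F} _ = refl

-- Incidence (mod 2) of an edge with endpoints P and a vertex t; a loop has
-- incidence 0 everywhere.
incidence : ∀ {v} → Fin v × Fin v → Fin v → Bool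
incidence (x , y) t = (x == t) xor (y == t)

incidence-joins : ∀ {v} (P : Fin v × Fin v) {u w} → Joins P u w →
                  ∀ t → incidence P t ≡ (u == t) xor (w == t)
incidence-joins (x , y) (inj₁ (refl , refl)) t = refl
incidence-joins (x , y) (inj₂ (refl , refl)) t = BoolP.xor-comm (x == t) (y == t)

-- Around a triangle every vertex is met twice.
triangle-cancels : ∀ a b c → (a xor b) xor ((b xor c) xor (c xor a)) ≡ false
triangle-cancels false false false = refl
triangle-cancels false false true  = refl
triangle-cancels false true  false = refl
triangle-cancels false true  true  = refl
triangle-cancels true  false false = refl
triangle-cancels true  false true  = refl
triangle-cancels true  true  false = refl
triangle-cancels true  true  true  = refl

incident-with-both : ∀ {v} (P : Fin v × Fin v) {u u′} → u ≢ u′ →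
                     incidence P u ≡ true → incidence P u′ ≡ true → Joins P u′ u
incident-with-both (x , y) {u} {u′} u≢u′ hu hu′
  with x == u in xu | y == u in yu | x == u′ in xu′ | y == u′ in yu′
... | true  | _     | true  | _     = ⊥-elim (u≢u′ (trans (sym (==-sound {x = x} xu)) (==-sound xu′)))
... | _     | true  | _     | true  = ⊥-elim (u≢u′ (trans (sym (==-sound {x = y} yu)) (==-sound yu′)))
... | true  | false | false | true  = inj₂ (==-sound xu , ==-sound yu′)
... | false | true  | true  | false = inj₁ (==-sound xu′ , ==-sound yu)
... | false | false | _     | _     = ⊥-elim (true≢false (sym hu))
... | true  | true  | false | false = ⊥-elim (true≢false (sym hu′))
... | false | true  | false | false = ⊥-elim (true≢false (sym hu′))
... | true  | false | false | false = ⊥-elim (true≢false (sym hu′))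

-- F₇ is not graphic
--
-- If in a graph with edge set the Fano points no pair of edges contains a
-- cycle (no loops, no parallel edges), then some line contains no cycle.
-- Otherwise every line is a triangle, so the incidence vector of each
-- vertex is orthogonal to all lines; two such vectors through the endpoints
-- of edge 0 share a second edge, which is then parallel to edge 0.

¬¬-all : ∀ n {P : Fin n → Set} → (∀ i → ¬ ¬ P i) → ¬ ¬ (∀ i → P i)
¬¬-all zero    h k = k (λ ())
¬¬-all (suc n) {P} h k = h zero (λ p₀ → ¬¬-all n {λ i → P (suc i)} (λ i → h (suc i))
  (λ ps → k (λ { zero → p₀ ; (suc i) → ps i })))

-- c is orthogonal to every line: it is a word of the code spanned by the
-- rows of the Fano matrix.
OrthogonalToLines : (Fin 7 → Bool) → Set
OrthogonalToLines c = ∀ q → xor3 (λ s → c (line q s)) ≡ false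

orthogonalᵇ : (Fin 7 → Bool) → Bool
orthogonalᵇ c = allFin 7 (λ q → not (xor3 (λ s → c (line q s))))

words-meet : ∀ c d → OrthogonalToLines c → OrthogonalToLines d → c 0F ≡ true → d 0F ≡ true →
             Σ (Fin 6) λ s → c (suc s) ≡ true × d (suc s) ≡ true
words-meet c d c⊥ d⊥ c₀ d₀ =
  s , trans (sym (normalise-≗ c (suc s))) (proj₁ both) ,
      trans (sym (normalise-≗ d (suc s))) (proj₂ both)
  where
  meet : (Fin 7 → Bool) → (Fin 7 → Bool) → Bool
  meet c d = not (orthogonalᵇ c ∧ (orthogonalᵇ d ∧ (c 0F ∧ d 0F)))
             ∨ anyFin 6 (λ s → c (suc s) ∧ d (suc s))
  checked : allVec 7 (λ c → allVec 7 (λ d → meet c d)) ≡ true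
  checked = refl
  orthogonal : ∀ x → OrthogonalToLines x → orthogonalᵇ (normalise x) ≡ true
  orthogonal x x⊥ = allFin-complete 7 _ (λ q → cong not (trans
    (cong₂ _xor_ (normalise-≗ x (line q 0F))
                 (cong₂ _xor_ (normalise-≗ x (line q 1F)) (normalise-≗ x (line q 2F))))
    (x⊥ q)))
  premises : orthogonalᵇ (normalise c) ∧ (orthogonalᵇ (normalise d) ∧ (normalise c 0F ∧ normalise d 0F))
           ≡ true
  premises rewrite orthogonal c c⊥ | orthogonal d d⊥ | c₀ | d₀ = refl
  found : Σ (Fin 6) λ s → normalise c (suc s) ∧ normalise d (suc s) ≡ true
  found = anyFin-sound 6 _ (modus-ponens (allVec-sound 7 (meet (normalise c))
            (allVec-sound 7 (λ c′ → allVec 7 (meet c′)) checked c) d) premises)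
  s = proj₁ found
  both = ∧-true (proj₂ found)

module _ {v : ℕ} (G : Graph v 7) (simple : ∀ x y → ¬ CycleIn G (pair x y)) where

  -- A cycle inside a line uses its three points, hence is a triangle, and at
  -- every vertex t the incidences of the three points cancel.
  line-orthogonal : ∀ q → CycleIn G (lineSet q) → ∀ t →
                    xor3 (λ s → incidence (G (line q s)) t) ≡ false
  line-orthogonal q (k , e , w , e-inj , w-inj , joins , inL) t =
    by-length k e w e-inj w-inj joins position position-inj position-spec
    where
    position : Fin (suc k) → Fin 3
    position i = proj₁ (lineSet-point q (e i) (inL i))
    position-spec : ∀ i → line q (position i) ≡ e i
    position-spec i = proj₂ (lineSet-point q (e i) (inL i))
    position-inj : Injective _≡_ _≡_ position
    position-inj {i} {j} p = e-inj (trans (sym (position-spec i)) (trans (cong (line q) p) (position-spec j)))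

    by-length : ∀ k (e : Fin (suc k) → Fin 7) (w : Fin (suc k) → Fin v) →
      Injective _≡_ _≡_ e → Injective _≡_ _≡_ w → (∀ i → Joins (G (e i)) (w i) (w (next i))) →
      (f : Fin (suc k) → Fin 3) → Injective _≡_ _≡_ f → (∀ i → line q (f i) ≡ e i) →
      xor3 (λ s → incidence (G (line q s)) t) ≡ false
    by-length 0 e w _ _ joins _ _ _ = ⊥-elim (simple (e 0F) (e 0F) (loop-cycle G (e 0F) (w 0F) (joins 0F)))
    by-length 1 e w e-inj w-inj joins _ _ _ =
      ⊥-elim (simple (e 0F) (e 1F)
        (parallel-cycle G (λ p → 0≢1 (e-inj p)) (λ p → 0≢1 (w-inj p)) (joins 0F) (joins 1F)))
      where 0≢1 : 0F ≢ 1F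
            0≢1 ()
    by-length 2 e w _ _ joins f f-inj f-spec = begin
      xor3 (λ s → incidence (G (line q s)) t)
        ≡⟨ sym (xor3-reindex (λ s → incidence (G (line q s)) t) f f-inj) ⟩
      xor3 (λ i → incidence (G (line q (f i))) t)
        ≡⟨ cong₂ _xor_ (at 0F) (cong₂ _xor_ (at 1F) (at 2F)) ⟩
      xor3 (λ i → incidence (G (e i)) t)
        ≡⟨ cong₂ _xor_ (walked 0F) (cong₂ _xor_ (walked 1F) (walked 2F)) ⟩
      ((w 0F == t) xor (w 1F == t)) xor (((w 1F == t) xor (w 2F == t)) xor ((w 2F == t) xor (w 0F == t)))
        ≡⟨ triangle-cancels (w 0F == t) (w 1F == t) (w 2F == t) ⟩
      false ∎
      where
      open ≡-Reasoning
      at : ∀ i → incidence (G (line q (f i))) t ≡ incidence (G (e i)) t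
      at i = cong (λ x → incidence (G x) t) (f-spec i)
      walked : ∀ i → incidence (G (e i)) t ≡ (w i == t) xor (w (next i) == t)
      walked i = incidence-joins _ (joins i) t
    by-length (suc (suc (suc k))) _ _ _ _ _ f f-inj _ with FinP.injective⇒≤ f-inj
    ... | s≤s (s≤s (s≤s ()))

  some-line-acyclic : ¬ (∀ q → CycleIn G (lineSet q))
  some-line-acyclic cyclic with G 0F in edge₀
  ... | (u , u′) with u FinP.≟ u′
  ...   | yes refl =
    simple 0F 0F (loop-cycle G 0F u (subst (λ P → Joins P u u) (sym edge₀) (inj₁ (refl , refl))))
  ...   | no u≢u′  =
    simple 0F (suc s) (parallel-cycle G (λ ()) u≢u′ joins₀
      (incident-with-both (G (suc s)) u≢u′ (proj₁ (proj₂ meet)) (proj₂ (proj₂ meet))))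
    where
    joins₀ : Joins (G 0F) u u′
    joins₀ = subst (λ P → Joins P u u′) (sym edge₀) (inj₁ (refl , refl))
    incident-u : incidence (G 0F) u ≡ true
    incident-u rewrite edge₀ | ==-refl u | ==-distinct (λ p → u≢u′ (sym p)) = refl
    incident-u′ : incidence (G 0F) u′ ≡ true
    incident-u′ rewrite edge₀ | ==-refl u′ | ==-distinct u≢u′ = refl
    meet = words-meet (λ t → incidence (G t) u) (λ t → incidence (G t) u′)
             (λ q → line-orthogonal q (cyclic q) u) (λ q → line-orthogonal q (cyclic q) u′)
             incident-u incident-u′
    s = proj₁ meet

-- The cycle matroid of G₁₂
--
-- Edges 0,1,2 form the triangle 01, 12, 20; edge 3+i is parallel to edge
-- i; edge 6 is a loop.  Its circuits are the loop, the three parallel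
-- pairs and the eight triangles; its bases are the 12 sets consisting of
-- one edge from each of two different parallel classes.

setOf : ∀ {n} → List (Fin n) → Fin n → Bool
setOf []      j = false
setOf (x ∷ l) j = (x == j) ∨ setOf l j

setOf-⊆ : ∀ {n} {J : Fin n → Bool} (l : List (Fin n)) → All (λ x → J x ≡ true) l → setOf l ⊆ J
setOf-⊆ {J = J} (x ∷ l) (Jx ∷ Jl) j h with ∨-true {x == j} h
... | inj₁ x≡j = subst (λ y → J y ≡ true) (==-sound x≡j) Jx
... | inj₂ j∈l = setOf-⊆ l Jl j j∈l

circuit : Fin 12 → Fin 7 → Bool
circuit 0F = setOf (6F ∷ [])
circuit 1F = setOf (0F ∷ 3F ∷ [])
circuit 2F = setOf (1F ∷ 4F ∷ [])
circuit 3F = setOf (2F ∷ 5F ∷ [])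
circuit 4F = setOf (0F ∷ 1F ∷ 2F ∷ [])
circuit 5F = setOf (0F ∷ 1F ∷ 5F ∷ [])
circuit 6F = setOf (0F ∷ 4F ∷ 2F ∷ [])
circuit 7F = setOf (0F ∷ 4F ∷ 5F ∷ [])
circuit 8F = setOf (3F ∷ 1F ∷ 2F ∷ [])
circuit 9F = setOf (3F ∷ 1F ∷ 5F ∷ [])
circuit (suc 9F) = setOf (3F ∷ 4F ∷ 2F ∷ [])
circuit (suc (suc 9F)) = setOf (3F ∷ 4F ∷ 5F ∷ [])

basis : Fin 12 → Fin 7 → Bool
basis 0F = setOf (0F ∷ 1F ∷ [])
basis 1F = setOf (0F ∷ 4F ∷ [])
basis 2F = setOf (3F ∷ 1F ∷ [])
basis 3F = setOf (3F ∷ 4F ∷ [])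
basis 4F = setOf (0F ∷ 2F ∷ [])
basis 5F = setOf (0F ∷ 5F ∷ [])
basis 6F = setOf (3F ∷ 2F ∷ [])
basis 7F = setOf (3F ∷ 5F ∷ [])
basis 8F = setOf (1F ∷ 2F ∷ [])
basis 9F = setOf (1F ∷ 5F ∷ [])
basis (suc 9F) = setOf (4F ∷ 2F ∷ [])
basis (suc (suc 9F)) = setOf (4F ∷ 5F ∷ [])

triangle : Fin 7 → Fin 7 → Fin 7 → Fin 3 → Fin 7
triangle a b c 0F = a
triangle a b c 1F = b
triangle a b c 2F = c

circuit-cycle : ∀ q → CycleIn G₁₂ (circuit q)
circuit-cycle 0F = checked-cycle G₁₂ (circuit 0F) 0 (λ _ → 6F) (λ _ → 0F) refl refl refl refl
circuit-cycle 1F = checked-cycle G₁₂ (circuit 1F) 1 (0F ∷ᵥ 3F ∷ᵥ []ᵥ) (0F ∷ᵥ 1F ∷ᵥ []ᵥ) refl refl refl refl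
circuit-cycle 2F = checked-cycle G₁₂ (circuit 2F) 1 (1F ∷ᵥ 4F ∷ᵥ []ᵥ) (1F ∷ᵥ 2F ∷ᵥ []ᵥ) refl refl refl refl
circuit-cycle 3F = checked-cycle G₁₂ (circuit 3F) 1 (2F ∷ᵥ 5F ∷ᵥ []ᵥ) (2F ∷ᵥ 0F ∷ᵥ []ᵥ) refl refl refl refl
circuit-cycle 4F = checked-cycle G₁₂ (circuit 4F) 2 (triangle 0F 1F 2F) (λ i → i) refl refl refl refl
circuit-cycle 5F = checked-cycle G₁₂ (circuit 5F) 2 (triangle 0F 1F 5F) (λ i → i) refl refl refl refl
circuit-cycle 6F = checked-cycle G₁₂ (circuit 6F) 2 (triangle 0F 4F 2F) (λ i → i) refl refl refl refl
circuit-cycle 7F = checked-cycle G₁₂ (circuit 7F) 2 (triangle 0F 4F 5F) (λ i → i) refl refl refl refl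
circuit-cycle 8F = checked-cycle G₁₂ (circuit 8F) 2 (triangle 3F 1F 2F) (λ i → i) refl refl refl refl
circuit-cycle 9F = checked-cycle G₁₂ (circuit 9F) 2 (triangle 3F 1F 5F) (λ i → i) refl refl refl refl
circuit-cycle q@(suc 9F) = checked-cycle G₁₂ (circuit q) 2 (triangle 3F 4F 2F) (λ i → i) refl refl refl refl
circuit-cycle q@(suc (suc 9F)) = checked-cycle G₁₂ (circuit q) 2 (triangle 3F 4F 5F) (λ i → i) refl refl refl refl

hasCircuit : (Fin 7 → Bool) → Bool
hasCircuit S = anyFin 12 (λ q → circuit q ⊆ᵇ S)

circuit-inside : ∀ {J} S → S ⊆ J → hasCircuit S ≡ true → Σ (Fin 12) λ q → circuit q ⊆ J
circuit-inside S S⊆J h with anyFin-sound 12 (λ q → circuit q ⊆ᵇ S) h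
... | q , circ⊆S = q , λ j cⱼ → S⊆J j (⊆ᵇ-sound {c = circuit q} {S = S} circ⊆S j cⱼ)

circuit-or-basisᵇ : (Fin 7 → Bool) → Bool
circuit-or-basisᵇ J = hasCircuit J ∨ anyFin 12 (λ q → J ⊆ᵇ basis q)

circuit-or-basis : ∀ J → (Σ (Fin 12) λ q → circuit q ⊆ J) ⊎ (Σ (Fin 12) λ q → J ⊆ basis q)
circuit-or-basis J with ∨-true {hasCircuit (normalise J)} (allVec-sound 7 circuit-or-basisᵇ refl J)
... | inj₁ h = inj₁ (circuit-inside (normalise J) (λ j e → trans (sym (normalise-≗ J j)) e) h)
... | inj₂ h with anyFin-sound 12 (λ q → normalise J ⊆ᵇ basis q) h
...   | q , J⊆basis =
  inj₂ (q , λ j Jⱼ → ⊆ᵇ-sound {c = normalise J} {S = basis q} J⊆basis j (trans (normalise-≗ J j) Jⱼ))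

-- Since G₁₂ has three
-- vertices, a cycle has at most three edges, and closed walks of length
-- one, two (along distinct edges and vertices) and three are checked
-- exhaustively.
walk₁-circuit : ∀ e₀ w₀ → Joins (G₁₂ e₀) w₀ w₀ → hasCircuit (setOf (e₀ ∷ [])) ≡ true
walk₁-circuit e₀ w₀ j₀ =
  modus-ponens (allFin²-sound 7 3 walk refl e₀ w₀) (joinsᵇ-complete (G₁₂ e₀) w₀ w₀ j₀)
  where
  walk : Fin 7 → Fin 3 → Bool
  walk e₀ w₀ = not (joinsᵇ (G₁₂ e₀) w₀ w₀) ∨ hasCircuit (setOf (e₀ ∷ []))

walk₂-circuit : ∀ e₀ e₁ w₀ w₁ → e₀ ≢ e₁ → w₀ ≢ w₁ → Joins (G₁₂ e₀) w₀ w₁ → Joins (G₁₂ e₁) w₁ w₀ →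
                hasCircuit (setOf (e₀ ∷ e₁ ∷ [])) ≡ true
walk₂-circuit e₀ e₁ w₀ w₁ e₀≢e₁ w₀≢w₁ j₀ j₁ =
  modus-ponens (allFin²-sound 3 3 (walk e₀ e₁)
                  (allFin²-sound 7 7 (λ e₀ e₁ → allFin 3 (λ w₀ → allFin 3 (walk e₀ e₁ w₀))) refl e₀ e₁)
                  w₀ w₁)
    (cong₂ _∧_ (cong not (==-distinct e₀≢e₁)) (cong₂ _∧_ (cong not (==-distinct w₀≢w₁))
      (cong₂ _∧_ (joinsᵇ-complete (G₁₂ e₀) w₀ w₁ j₀) (joinsᵇ-complete (G₁₂ e₁) w₁ w₀ j₁))))
  where
  walk : Fin 7 → Fin 7 → Fin 3 → Fin 3 → Bool
  walk e₀ e₁ w₀ w₁ =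
    not (not (e₀ == e₁) ∧ (not (w₀ == w₁) ∧ (joinsᵇ (G₁₂ e₀) w₀ w₁ ∧ joinsᵇ (G₁₂ e₁) w₁ w₀)))
    ∨ hasCircuit (setOf (e₀ ∷ e₁ ∷ []))

walk₃-circuit : ∀ e₀ e₁ e₂ w₀ w₁ w₂ → Joins (G₁₂ e₀) w₀ w₁ → Joins (G₁₂ e₁) w₁ w₂ →
                Joins (G₁₂ e₂) w₂ w₀ → hasCircuit (setOf (e₀ ∷ e₁ ∷ e₂ ∷ [])) ≡ true
walk₃-circuit e₀ e₁ e₂ w₀ w₁ w₂ j₀ j₁ j₂ =
  modus-ponens (allFin³-sound 3 3 3 (walk e₀ e₁ e₂)
                  (allFin³-sound 7 7 7
                     (λ e₀ e₁ e₂ → allFin 3 λ w₀ → allFin 3 λ w₁ → allFin 3 (walk e₀ e₁ e₂ w₀ w₁))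
                     refl e₀ e₁ e₂)
                  w₀ w₁ w₂)
    (cong₂ _∧_ (joinsᵇ-complete (G₁₂ e₀) w₀ w₁ j₀)
      (cong₂ _∧_ (joinsᵇ-complete (G₁₂ e₁) w₁ w₂ j₁) (joinsᵇ-complete (G₁₂ e₂) w₂ w₀ j₂)))
  where
  walk : Fin 7 → Fin 7 → Fin 7 → Fin 3 → Fin 3 → Fin 3 → Bool
  walk e₀ e₁ e₂ w₀ w₁ w₂ =
    not (joinsᵇ (G₁₂ e₀) w₀ w₁ ∧ (joinsᵇ (G₁₂ e₁) w₁ w₂ ∧ joinsᵇ (G₁₂ e₂) w₂ w₀))
    ∨ hasCircuit (setOf (e₀ ∷ e₁ ∷ e₂ ∷ []))

cycle⇒circuit : ∀ {J} → CycleIn G₁₂ J → Σ (Fin 12) λ q → circuit q ⊆ J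
cycle⇒circuit {J} (k , e , w , e-inj , w-inj , joins , inJ) =
  by-length k e w e-inj w-inj joins inJ (FinP.injective⇒≤ w-inj)
  where
  0≢1 : ∀ {n} → _≡_ {A = Fin (suc (suc n))} 0F 1F → ⊥
  0≢1 ()
  by-length : ∀ k (e : Fin (suc k) → Fin 7) (w : Fin (suc k) → Fin 3) →
    Injective _≡_ _≡_ e → Injective _≡_ _≡_ w → (∀ i → Joins (G₁₂ (e i)) (w i) (w (next i))) →
    (∀ i → J (e i) ≡ true) → suc k ≤ 3 → Σ (Fin 12) λ q → circuit q ⊆ J
  by-length 0 e w _ _ joins inJ _ =
    circuit-inside _ (setOf-⊆ (e 0F ∷ []) (inJ 0F ∷ []))
      (walk₁-circuit (e 0F) (w 0F) (joins 0F))
  by-length 1 e w e-inj w-inj joins inJ _ =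
    circuit-inside _ (setOf-⊆ (e 0F ∷ e 1F ∷ []) (inJ 0F ∷ inJ 1F ∷ []))
      (walk₂-circuit (e 0F) (e 1F) (w 0F) (w 1F) (λ p → 0≢1 (e-inj p)) (λ p → 0≢1 (w-inj p))
                     (joins 0F) (joins 1F))
  by-length 2 e w _ _ joins inJ _ =
    circuit-inside _ (setOf-⊆ (e 0F ∷ e 1F ∷ e 2F ∷ []) (inJ 0F ∷ inJ 1F ∷ inJ 2F ∷ []))
      (walk₃-circuit (e 0F) (e 1F) (e 2F) (w 0F) (w 1F) (w 2F) (joins 0F) (joins 1F) (joins 2F))
  by-length (suc (suc (suc k))) _ _ _ _ _ _ (s≤s (s≤s (s≤s ())))

-- Finite facts about the rows (w , x·F)
--
-- These are the computations behind the two cases of the proof; they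
-- mention neither N nor B.  Σ_{t∈c} F_t is the sum of the Fano columns
-- selected by c, and pointOf v is the point with vector v (no point if
-- v = 0).

columnSum : (Fin 7 → Bool) → Fin 3 → Bool
columnSum c i = ⊕ (λ t → c t ∧ fanoMatrix i t)

pointOf : (Fin 3 → Bool) → Fin 7 → Bool
pointOf v t = allFin 3 (λ i → not (v i xor fanoMatrix i t))

points : List (Fin 8 → Bool)
points = tabulate (λ t → false ∷ᵥ pair t t)

points-with-a : List (Fin 8 → Bool)
points-with-a = (true ∷ᵥ ∅) ∷ (tabulate (λ t → true ∷ᵥ pair t t) ++ points)

-- If the rows are (w , x·F), any c is equivalent to the reduced vector
-- (c₀ , pointOf (Σ_{t∈c} F_t)); when a is neither a loop nor parallel to a
-- Fano point, this certifies that a together with any two points is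
-- independent.
reduce-free : (Fin 8 → Bool) → Fin 8 → Bool
reduce-free c = c 0F ∷ᵥ pointOf (columnSum (λ t → c (suc t)))

free-certificate : ∀ x y →
  IndepCertificate (Transfersᵇ generalRow ∅) points-with-a reduce-free (true ∷ᵥ pair x y) ≡ true
free-certificate = allFin²-sound 7 7 _ refl

-- When moreover a is parallel to m, the relation a = m reduces every c
-- to a vector with at most one Fano point.  The bijection π m sends the
-- Fano points to the edges of G₁₂: m to the loop and the two further points
-- of the k-th line through m to the k-th parallel class.
π : Fin 7 → Fin 7 → Fin 7
π 0F = 6F ∷ᵥ 0F ∷ᵥ 3F ∷ᵥ 1F ∷ᵥ 4F ∷ᵥ 2F ∷ᵥ 5F ∷ᵥ []ᵥ
π 1F = 0F ∷ᵥ 6F ∷ᵥ 3F ∷ᵥ 1F ∷ᵥ 2F ∷ᵥ 4F ∷ᵥ 5F ∷ᵥ []ᵥ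
π 2F = 0F ∷ᵥ 3F ∷ᵥ 6F ∷ᵥ 1F ∷ᵥ 2F ∷ᵥ 5F ∷ᵥ 4F ∷ᵥ []ᵥ
π 3F = 0F ∷ᵥ 1F ∷ᵥ 2F ∷ᵥ 6F ∷ᵥ 3F ∷ᵥ 4F ∷ᵥ 5F ∷ᵥ []ᵥ
π 4F = 0F ∷ᵥ 1F ∷ᵥ 2F ∷ᵥ 3F ∷ᵥ 6F ∷ᵥ 5F ∷ᵥ 4F ∷ᵥ []ᵥ
π 5F = 0F ∷ᵥ 1F ∷ᵥ 2F ∷ᵥ 4F ∷ᵥ 5F ∷ᵥ 6F ∷ᵥ 3F ∷ᵥ []ᵥ
π 6F = 0F ∷ᵥ 1F ∷ᵥ 2F ∷ᵥ 5F ∷ᵥ 4F ∷ᵥ 3F ∷ᵥ 6F ∷ᵥ []ᵥ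

search : ∀ {n} → (Fin (suc n) → Bool) → Fin (suc n)
search {zero}  p = 0F
search {suc n} p = if p 0F then 0F else suc (search (λ i → p (suc i)))

π⁻¹ : Fin 7 → Fin 7 → Fin 7
π⁻¹ m e = search (λ t → π m t == e)

π-bijection : Fin 7 → Fin 7 ↔ Fin 7
π-bijection m = Perm.permutation (π m) (π⁻¹ m)
  (λ e → ==-sound (allFin²-sound 7 7 (λ m e → π m (π⁻¹ m e) == e) refl m e))
  (λ t → ==-sound (allFin²-sound 7 7 (λ m t → π⁻¹ m (π m t) == t) refl m t))

reduce-parallel : Fin 7 → (Fin 8 → Bool) → Fin 8 → Bool
reduce-parallel m c = false ∷ᵥ pointOf (λ i → columnSum (λ t → c (suc t)) i xor (c 0F ∧ fanoMatrix i m))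

basis-certificate : ∀ m q →
  IndepCertificate (Transfersᵇ generalRow (true ∷ᵥ pair m m)) points (reduce-parallel m)
                   (true ∷ᵥ (λ t → basis q (π m t))) ≡ true
basis-certificate = allFin²-sound 7 12 _ refl

-- … while each circuit of G₁₂ carries the dependency (ε , circuit), with
-- ε = 1 iff the Fano columns of the circuit do not already sum to zero.
witness : Fin 7 → Fin 12 → Fin 8 → Bool
witness m q = anyFin 3 (columnSum (λ t → circuit q (π m t))) ∷ᵥ (λ t → circuit q (π m t))

circuit-certificate : ∀ m q →
  Transfersᵇ generalRow (true ∷ᵥ pair m m) ∅ (witness m q) ∧ anyFin 7 (λ t → circuit q (π m t)) ≡ true
circuit-certificate = allFin²-sound 7 12 _ refl

-- Deletion and contraction in coordinates

module _ {n : ℕ} (a : Fin (suc n)) where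

  ext-at : ∀ J → ext a J a ≡ false
  ext-at J with a FinP.≟ a
  ... | yes _   = refl
  ... | no a≢a = ⊥-elim (a≢a refl)

  ext-punchIn : ∀ J y → ext a J (punchIn a y) ≡ J y
  ext-punchIn J y with a FinP.≟ punchIn a y
  ... | yes p = ⊥-elim (FinP.punchInᵢ≢i a y (sym p))
  ... | no _  = cong J (trans (FinP.punchOut-cong a refl) (FinP.punchOut-punchIn a))

  ins-at : ∀ J → ins a J a ≡ true
  ins-at J with a FinP.≟ a
  ... | yes _   = refl
  ... | no a≢a = ⊥-elim (a≢a refl)

  ins-punchIn : ∀ J y → ins a J (punchIn a y) ≡ J y
  ins-punchIn J y with a FinP.≟ punchIn a y
  ... | yes p = ⊥-elim (FinP.punchInᵢ≢i a y (sym p))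
  ... | no _  = cong J (trans (FinP.punchOut-cong a refl) (FinP.punchOut-punchIn a))

  single-at : single a a ≡ true
  single-at with a FinP.≟ a
  ... | yes _   = refl
  ... | no a≢a = ⊥-elim (a≢a refl)

  single-punchIn : ∀ y → single a (punchIn a y) ≡ false
  single-punchIn y with a FinP.≟ punchIn a y
  ... | yes p = ⊥-elim (FinP.punchInᵢ≢i a y (sym p))
  ... | no _  = refl

-- The matrix B: A with its columns reordered so that column 0 is a and
-- column 1+t is the element of N\a that σ sends to the Fano point t.  In
-- B, deletion of a is restriction to the columns 1…7 and contraction of a
-- is expressed by adding or omitting column 0.
module NormalForm {r : ℕ} (A : Fin r → Fin 8 → Bool) (a : Fin 8) (σ : Fin 7 ↔ Fin 7)
  (hσ : ∀ (J : Fin 7 → Bool) → (F₇ J → delete (BinIndep A) a (λ x → J (Inverse.to σ x))) ×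
                               (delete (BinIndep A) a (λ x → J (Inverse.to σ x)) → F₇ J)) where

  to   = Inverse.to σ
  from = Inverse.from σ

  to-from : ∀ y → to (from y) ≡ y
  to-from y = Inverse.inverseˡ σ refl

  ρ : Fin 8 ↔ Fin 8
  ρ = Perm.insert 0F a (Perm.flip σ)

  B : Fin r → Fin 8 → Bool
  B i j = A i (Inverse.to ρ j)

  IndepB : (Fin 8 → Bool) → Set
  IndepB = BinIndep B

  private
    open ColumnPermutation ρ

    toB : ∀ {S T} → (∀ k → T k ≡ S (Inverse.to ρ k)) → BinIndep A S → IndepB T
    toB T≗S indep = BinIndep-≗ {A = B} T≗S (permute {A = A} indep)

    fromB : ∀ {S T} → (∀ k → T k ≡ S (Inverse.to ρ k)) → IndepB T → BinIndep A S
    fromB T≗S indep = unpermute {A = A} (BinIndep-≗ {A = B} (λ k → sym (T≗S k)) indep)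

    ext≗ : ∀ J k → (false ∷ᵥ J) k ≡ ext a (λ x → J (to x)) (Inverse.to ρ k)
    ext≗ J 0F      = sym (ext-at a _)
    ext≗ J (suc t) = sym (trans (ext-punchIn a _ (from t)) (cong J (to-from t)))

    ins≗ : ∀ J k → (true ∷ᵥ J) k ≡ ins a (λ x → J (to x)) (Inverse.to ρ k)
    ins≗ J 0F      = sym (ins-at a _)
    ins≗ J (suc t) = sym (trans (ins-punchIn a _ (from t)) (cong J (to-from t)))

    single≗ : ∀ k → (true ∷ᵥ ∅) k ≡ single a (Inverse.to ρ k)
    single≗ 0F      = sym (single-at a)
    single≗ (suc t) = sym (single-punchIn a (from t))

  fano→B : ∀ J → F₇ J → IndepB (false ∷ᵥ J)
  fano→B J fano = toB (ext≗ J) (proj₁ (hσ J) fano)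

  B→fano : ∀ J → IndepB (false ∷ᵥ J) → F₇ J
  B→fano J indep = proj₂ (hσ J) (fromB (ext≗ J) indep)

  C : Indep 7
  C = contract (BinIndep A) a

  ContractionIndep : (Fin 7 → Bool) → Set
  ContractionIndep I = (¬ IndepB (true ∷ᵥ ∅) × IndepB (false ∷ᵥ I))
                     ⊎ (IndepB (true ∷ᵥ ∅) × IndepB (true ∷ᵥ I))

  C→B : ∀ I → C (λ x → I (to x)) → ContractionIndep I
  C→B I (inj₁ (a-loop , indep))  = inj₁ ((λ h → a-loop (fromB single≗ h)) , toB (ext≗ I) indep)
  C→B I (inj₂ (a-indep , indep)) = inj₂ (toB single≗ a-indep , toB (ins≗ I) indep)

  B→C : ∀ I → ContractionIndep I → C (λ x → I (to x))
  B→C I (inj₁ (a-loop , indep))  = inj₁ ((λ h → a-loop (toB single≗ h)) , fromB (ext≗ I) indep)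
  B→C I (inj₂ (a-indep , indep)) = inj₂ (fromB single≗ a-indep , fromB (ins≗ I) indep)

  Dependency : (Fin 8 → Bool) → Set
  Dependency = Kernel B

  dependency? : ∀ c → Dec (Dependency c)
  dependency? c = FinP.all? (λ i → dot c (B i) BoolP.≟ false)

  no-dependency : ∀ {T c} → IndepB T → c ⊆ T → Dependency c → ∀ j → c j ≡ true → ⊥
  no-dependency = indep⇒no-dependency {A = B}

  pair-not-dependency : ∀ x y → ¬ Dependency (false ∷ᵥ pair x y)
  pair-not-dependency x y z =
    no-dependency (fano→B (pair x y) (F₇-pair x y)) (λ _ e → e) z (suc x) (pair-fst x y)

  points-not-dependencies : All (λ k → ¬ Dependency k) points
  points-not-dependencies = AllP.tabulate⁺ {f = λ t → false ∷ᵥ pair t t} (λ t → pair-not-dependency t t)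

  -- … while every line is a dependency: otherwise the line, all of whose
  -- proper subsets are independent, would be independent in B, hence in F₇.
  line-dependency : ∀ q → Dependency (false ∷ᵥ lineSet q)
  line-dependency q with dependency? (false ∷ᵥ lineSet q)
  ... | yes z = z
  ... | no nz = ⊥-elim (F₇-line q (B→fano (lineSet q) line-indep))
    where
    nonempty-subsets : Fin 7 → List (Fin 8 → Bool)
    nonempty-subsets q =
      (false ∷ᵥ lineSet q) ∷ sub 0F 0F ∷ sub 1F 1F ∷ sub 2F 2F ∷ sub 0F 1F ∷ sub 0F 2F ∷ sub 1F 2F ∷ []
      where sub : Fin 3 → Fin 3 → Fin 8 → Bool
            sub s s′ = false ∷ᵥ pair (line q s) (line q s′)
    not-dependencies : All (λ k → ¬ Dependency k) (nonempty-subsets q)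
    not-dependencies = nz ∷ ok 0F 0F ∷ ok 1F 1F ∷ ok 2F 2F ∷ ok 0F 1F ∷ ok 0F 2F ∷ ok 1F 2F ∷ []
      where ok : ∀ s s′ → ¬ Dependency (false ∷ᵥ pair (line q s) (line q s′))
            ok s s′ = pair-not-dependency (line q s) (line q s′)
    line-indep : IndepB (false ∷ᵥ lineSet q)
    line-indep =
      certified-indep {A = B} _≐ᵇ_ (λ c d c≐d → Kernel-cong {A = B} (≐ᵇ-sound {c = c} {d = d} c≐d))
        (nonempty-subsets q) not-dependencies (λ c → c) (false ∷ᵥ lineSet q)
        (allFin-sound 7 (λ q → IndepCertificate _≐ᵇ_ (nonempty-subsets q) (λ c → c) (false ∷ᵥ lineSet q))
                      refl q)

  -- Every row of B is orthogonal to all lines, hence of the form (w , x·F).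
  row-shape : ∀ i j → B i j ≡ generalRow (coordinates (B i)) j
  row-shape i = orthogonal⇒generalRow (B i) (λ q → line-dependency q i)

  open RowFamily B generalRow generalRow-cong (λ i → coordinates (B i)) row-shape

  data NotParallel : Set where
    loop : Dependency (true ∷ᵥ ∅) → NotParallel
    free : ¬ Dependency (true ∷ᵥ ∅) → (∀ m → ¬ Dependency (true ∷ᵥ pair m m)) → NotParallel

  position : (Σ (Fin 7) λ m → Dependency (true ∷ᵥ pair m m)) ⊎ NotParallel
  position with FinP.any? (λ m → dependency? (true ∷ᵥ pair m m))
  ... | yes parallel = inj₁ parallel
  ... | no not-parallel with dependency? (true ∷ᵥ ∅)
  ...   | yes a-loop   = inj₂ (loop a-loop)
  ...   | no a-nonloop = inj₂ (free a-nonloop (λ m a∥m → not-parallel (m , a∥m)))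

  pair-contraction : NotParallel → ∀ x y → ContractionIndep (pair x y)
  pair-contraction (loop a-loop) x y =
    inj₁ ((λ indep → no-dependency indep (λ _ e → e) a-loop 0F refl) , fano→B (pair x y) (F₇-pair x y))
  pair-contraction (free a-nonloop not-parallel) x y =
    inj₂ (BinIndep-mono {A = B} (∷-⊆ true λ _ ()) (indep-with-a 0F 0F) , indep-with-a x y)
    where
    not-dependencies : All (λ k → ¬ Dependency k) points-with-a
    not-dependencies =
      a-nonloop ∷ AllP.++⁺ (AllP.tabulate⁺ {f = λ t → true ∷ᵥ pair t t} not-parallel) points-not-dependencies
    indep-with-a : ∀ x y → IndepB (true ∷ᵥ pair x y)
    indep-with-a x y =
      certified-indep {A = B} (Transfersᵇ generalRow ∅) (transfer {known = ∅} (Kernel-zero B))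
        points-with-a not-dependencies reduce-free (true ∷ᵥ pair x y) (free-certificate x y)

  line-contraction : ∀ q → ¬ ContractionIndep (lineSet q)
  line-contraction q (inj₁ (_ , indep)) =
    no-dependency indep (λ _ e → e) (line-dependency q) (suc (line q 0F)) (line-point q 0F)
  line-contraction q (inj₂ (_ , indep)) =
    no-dependency {c = false ∷ᵥ lineSet q} indep (λ { (suc t) e → e })
      (line-dependency q) (suc (line q 0F)) (line-point q 0F)

  -- Hence N/a is not graphic: a graph representing it would be a graph on
  -- the Fano points without loops and parallel edges in which every line
  -- contains a cycle.
  not-graphic : NotParallel → ¬ Graphic C
  not-graphic np (v , G , represents) = ¬¬-all 7 line-cyclic (some-line-acyclic G′ simple)
    where
    G′ : Graph v 7
    G′ t = G (from t)
    simple : ∀ x y → ¬ CycleIn G′ (pair x y)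
    simple x y cycle =
      proj₁ (represents _) (B→C (pair x y) (pair-contraction np x y))
        (renamed-cycle→ G σ {J = pair x y} cycle)
    line-cyclic : ∀ q → ¬ ¬ CycleIn G′ (lineSet q)
    line-cyclic q acyclic = line-contraction q (C→B (lineSet q)
      (proj₂ (represents _) (λ cycle → acyclic (renamed-cycle← G σ {J = lineSet q} cycle))))

  module Parallel (m : Fin 7) (a∥m : Dependency (true ∷ᵥ pair m m)) where

    transfer-a∥m : ∀ c d → Transfersᵇ generalRow (true ∷ᵥ pair m m) c d ≡ true → Dependency c → Dependency d
    transfer-a∥m = transfer {known = true ∷ᵥ pair m m} a∥m

    basis-indep : ∀ q → IndepB (true ∷ᵥ (λ t → basis q (π m t)))
    basis-indep q =
      certified-indep {A = B} (Transfersᵇ generalRow (true ∷ᵥ pair m m)) transfer-a∥m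
        points points-not-dependencies (reduce-parallel m) _ (basis-certificate m q)

    a-indep : IndepB (true ∷ᵥ ∅)
    a-indep = BinIndep-mono {A = B} (∷-⊆ true λ _ ()) (basis-indep 0F)

    circuit-dep : ∀ q → ¬ IndepB (true ∷ᵥ (λ t → circuit q (π m t)))
    circuit-dep q indep with ∧-true (circuit-certificate m q)
    ... | witness-dependency , nonempty with anyFin-sound 7 (λ t → circuit q (π m t)) nonempty
    ...   | t , t∈circuit =
      no-dependency {c = witness m q} indep (λ { 0F _ → refl ; (suc t) e → e })
        (transfer-a∥m ∅ (witness m q) witness-dependency (Kernel-zero B)) (suc t) t∈circuit

    forest→indep : ∀ J → ¬ CycleIn G₁₂ J → ContractionIndep (λ t → J (π m t))
    forest→indep J acyclic with circuit-or-basis J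
    ... | inj₁ (q , circuit⊆J) =
      ⊥-elim (acyclic (cycle-mono G₁₂ {I = circuit q} circuit⊆J (circuit-cycle q)))
    ... | inj₂ (q , J⊆basis)   =
      inj₂ (a-indep , BinIndep-mono {A = B} (∷-⊆ true λ t → J⊆basis (π m t)) (basis-indep q))

    indep→forest : ∀ J → ContractionIndep (λ t → J (π m t)) → ¬ CycleIn G₁₂ J
    indep→forest J (inj₁ (a-dep , _)) _ = a-dep a-indep
    indep→forest J (inj₂ (_ , indep)) cycle with cycle⇒circuit {J = J} cycle
    ... | q , circuit⊆J =
      circuit-dep q (BinIndep-mono {A = B} (∷-⊆ true λ t → circuit⊆J (π m t)) indep)

    contraction≅G₁₂ : C ≅ CycleMatroid G₁₂
    contraction≅G₁₂ = σ Perm.∘ₚ π-bijection m ,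
      λ J → (λ acyclic → B→C (λ t → J (π m t)) (forest→indep J acyclic)) ,
            (λ indep → indep→forest J (C→B (λ t → J (π m t)) indep))

  contraction-is-G₁₂ : Graphic C → C ≅ CycleMatroid G₁₂
  contraction-is-G₁₂ graphic with position
  ... | inj₁ (m , a∥m) = Parallel.contraction≅G₁₂ m a∥m
  ... | inj₂ np        = ⊥-elim (not-graphic np graphic)

lemma4p3 : ∀ {r n} (A : Fin r → Fin (suc n) → Bool) (a : Fin (suc n)) →
    delete (BinIndep A) a ≅ F₇ →
    Graphic (contract (BinIndep A) a) →
    contract (BinIndep A) a ≅ CycleMatroid G₁₂
lemma4p3 A a (σ , hσ) graphic with Perm.↔⇒≡ σ
... | refl = NormalForm.contraction-is-G₁₂ A a σ hσ graphic
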